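{- Let $(L,{}')$ be a quantum logic and let $x, y \in L$. If $\{u, v, w\}$ is a compatible decomposition for $x$ and $y$, then $u = x \wedge y'$, $w = x' \wedge y$, and $v = x \wedge y = (x' \vee y) \wedge x = (x \vee y') \wedge y$. In particular, $u$, $v$, $w$ are uniquely determined by $x$ and $y$.
   Context: Let $L$ be a lattice with universal bounds $0$ and $1$. A mapping $': L\to L$ is a fuzzy negation if for all $x,y\in L$: $x \leqq (x')'$; $x\leqq y$ implies $y'\leqq x'$; $0'=1$ and $1'=0$. $(L,{}')$ is a logic if moreover $x\wedge x' = 0$ for all $x$, and a quantum logic if it is a logic satisfying the orthomodular identity: $x \leqq y$ implies $x \vee (x'\wedge y) = y$. Two elements $a,b\in L$ are orthogonal if $a\wedge b = 0$, $a \leqq b'$ and $b \leqq a'$. For $x,y\in L$, a triple $\{u,v,w\}\subseteq L$ is a compatible decomposition for $x$ and $y$ if (i) $u,v,w$ are pairwise orthogonal; (ii) $u\vee v = x$ and $v \vee w = y$; (iii) every pair $a,b$ of elements of the set $\{u,v,w,x,y,u',v',w',x',y'\}$ satisfies the orthomodular identity ($a\leqq b$ implies $a\vee(a'\wedge b) = b$). Elements $x,y$ are called compatible if a compatible decomposition for them exists. -}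

module Defs where

open import Level using (Level; _⊔_)
open import Data.Product using (_×_)
open import Relation.Binary.Lattice.Bundles using (BoundedLattice)

module _ {c ℓ₁ ℓ₂ : Level} (L : BoundedLattice c ℓ₁ ℓ₂) where
  open BoundedLattice L

  OMPair : (Carrier → Carrier) → Carrier → Carrier → Set (ℓ₁ ⊔ ℓ₂)
  OMPair _′ a b = a ≤ b → (a ∨ ((a ′) ∧ b)) ≈ b

  record IsFuzzyNegation (_′ : Carrier → Carrier) : Set (c ⊔ ℓ₁ ⊔ ℓ₂) where
    field
      involutive-≤ : ∀ x → x ≤ ((x ′) ′)
      antitone     : ∀ x y → x ≤ y → (y ′) ≤ (x ′)
      ⊥′≈⊤         : (⊥ ′) ≈ ⊤
      ⊤′≈⊥         : (⊤ ′) ≈ ⊥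

  record IsLogic (_′ : Carrier → Carrier) : Set (c ⊔ ℓ₁ ⊔ ℓ₂) where
    field
      isFuzzyNegation : IsFuzzyNegation _′
      noncontradiction : ∀ x → (x ∧ (x ′)) ≈ ⊥

  record IsQuantumLogic (_′ : Carrier → Carrier) : Set (c ⊔ ℓ₁ ⊔ ℓ₂) where
    field
      isLogic      : IsLogic _′
      orthomodular : ∀ x y → OMPair _′ x y

  Orthogonal : (Carrier → Carrier) → Carrier → Carrier → Set (ℓ₁ ⊔ ℓ₂)
  Orthogonal _′ a b = ((a ∧ b) ≈ ⊥) × (a ≤ (b ′)) × (b ≤ (a ′))

  data InTen (_′ : Carrier → Carrier) (u v w x y : Carrier) : Carrier → Set c where
    e-u : InTen _′ u v w x y u
    e-v : InTen _′ u v w x y v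
    e-w : InTen _′ u v w x y w
    e-x : InTen _′ u v w x y x
    e-y : InTen _′ u v w x y y
    e-u′ : InTen _′ u v w x y (u ′)
    e-v′ : InTen _′ u v w x y (v ′)
    e-w′ : InTen _′ u v w x y (w ′)
    e-x′ : InTen _′ u v w x y (x ′)
    e-y′ : InTen _′ u v w x y (y ′)

  record CompatibleDecomposition (_′ : Carrier → Carrier) (x y u v w : Carrier)
         : Set (c ⊔ ℓ₁ ⊔ ℓ₂) where
    field
      orth-uv : Orthogonal _′ u v
      orth-uw : Orthogonal _′ u w
      orth-vw : Orthogonal _′ v w
      u∨v≈x   : (u ∨ v) ≈ x
      v∨w≈y   : (v ∨ w) ≈ y
      om-ten  : ∀ a b → InTen _′ u v w x y a → InTen _′ u v w x y b → OMPair _′ a b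

module Submission where

-- Every identity is a squeeze v ≤ t ≤ v (and likewise for u, w).  The upper bounds come from
-- one consequence of orthomodularity: if b ≤ a′ then a′ ∧ (a ∨ b) = b, so anything below both
-- a′ and a ∨ b is below b.  Applied to x = u ∨ v and y = v ∨ w it reads u′ ∧ x = v, v′ ∧ x = u,
-- v′ ∧ y = w and w′ ∧ y = v, and each right-hand side of the theorem lies below one of these.

open import Defs
open import Level using (Level)
open import Data.Product using (_×_; _,_)
open import Relation.Binary.Lattice.Bundles using (BoundedLattice)

module _ {c ℓ₁ ℓ₂ : Level} (L : BoundedLattice c ℓ₁ ℓ₂)
         (_′ : BoundedLattice.Carrier L → BoundedLattice.Carrier L) where
  open BoundedLattice L

  orthogonal⇒≤′ : ∀ {a b} → Orthogonal L _′ a b → a ≤ b ′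
  orthogonal⇒≤′ (_ , a≤b′ , _) = a≤b′

  ≤x∨y⇒≤y∨x : ∀ {a b t} → t ≤ a ∨ b → t ≤ b ∨ a
  ≤x∨y⇒≤y∨x t≤a∨b = trans t≤a∨b (∨-least (y≤x∨y _ _) (x≤x∨y _ _))

  module FuzzyNegationProperties (N : IsFuzzyNegation L _′) where
    open IsFuzzyNegation N

    x≤y′⇒y≤x′ : ∀ {a b} → a ≤ b ′ → b ≤ a ′
    x≤y′⇒y≤x′ {a} {b} a≤b′ = trans (involutive-≤ b) (antitone a (b ′) a≤b′)

    x′∧y′≤[x∨y]′ : ∀ a b → (a ′ ∧ b ′) ≤ (a ∨ b) ′
    x′∧y′≤[x∨y]′ a b = x≤y′⇒y≤x′
      (∨-least (x≤y′⇒y≤x′ (x∧y≤x _ _)) (x≤y′⇒y≤x′ (x∧y≤y _ _)))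

  module QuantumLogicProperties (Q : IsQuantumLogic L _′) where
    open IsQuantumLogic Q
    open IsLogic isLogic
    open FuzzyNegationProperties isFuzzyNegation public

    ≤x∧≤x′⇒≤⊥ : ∀ {a t} → t ≤ a → t ≤ a ′ → t ≤ ⊥
    ≤x∧≤x′⇒≤⊥ t≤a t≤a′ = trans (∧-greatest t≤a t≤a′) (reflexive (noncontradiction _))

    x≤z∧x′∧z≤⊥⇒z≤x : ∀ {a z} → a ≤ z → (a ′ ∧ z) ≤ ⊥ → z ≤ a
    x≤z∧x′∧z≤⊥⇒z≤x {a} {z} a≤z a′∧z≤⊥ =
      trans (reflexive (Eq.sym (orthomodular a z a≤z)))
            (∨-least refl (trans a′∧z≤⊥ (minimum a)))

    ≤x′∧x∨y⇒≤y : ∀ {a b t} → b ≤ a ′ → t ≤ a ′ → t ≤ a ∨ b → t ≤ b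
    ≤x′∧x∨y⇒≤y {a} {b} b≤a′ t≤a′ t≤a∨b = trans (∧-greatest t≤a′ t≤a∨b) z≤b
      where
        z≤b : (a ′ ∧ (a ∨ b)) ≤ b
        -- b′ ∧ (a′ ∧ (a ∨ b)) lies below both a ∨ b and a′ ∧ b′ ≤ (a ∨ b)′.
        z≤b = x≤z∧x′∧z≤⊥⇒z≤x (∧-greatest b≤a′ (y≤x∨y a b))
          (≤x∧≤x′⇒≤⊥ (trans (x∧y≤y _ _) (x∧y≤y _ _))
            (trans (∧-greatest (trans (x∧y≤y _ _) (x∧y≤x _ _)) (x∧y≤x _ _))
                   (x′∧y′≤[x∨y]′ a b)))

    ≤y′∧x∨y⇒≤x : ∀ {a b t} → a ≤ b ′ → t ≤ b ′ → t ≤ a ∨ b → t ≤ a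
    ≤y′∧x∨y⇒≤x a≤b′ t≤b′ t≤a∨b = ≤x′∧x∨y⇒≤y a≤b′ t≤b′ (≤x∨y⇒≤y∨x t≤a∨b)

  module CompatibleDecompositionProperties (Q : IsQuantumLogic L _′) {x y u v w : Carrier}
         (D : CompatibleDecomposition L _′ x y u v w) where
    open IsQuantumLogic Q
    open IsLogic isLogic
    open IsFuzzyNegation isFuzzyNegation
    open QuantumLogicProperties Q
    open CompatibleDecomposition D

    u≤x : u ≤ x
    u≤x = trans (x≤x∨y u v) (reflexive u∨v≈x)

    v≤x : v ≤ x
    v≤x = trans (y≤x∨y u v) (reflexive u∨v≈x)

    v≤y : v ≤ y
    v≤y = trans (x≤x∨y v w) (reflexive v∨w≈y)

    w≤y : w ≤ y
    w≤y = trans (y≤x∨y v w) (reflexive v∨w≈y)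

    ≤x⇒≤u∨v : ∀ {t} → t ≤ x → t ≤ u ∨ v
    ≤x⇒≤u∨v t≤x = trans t≤x (reflexive (Eq.sym u∨v≈x))

    ≤y⇒≤v∨w : ∀ {t} → t ≤ y → t ≤ v ∨ w
    ≤y⇒≤v∨w t≤y = trans t≤y (reflexive (Eq.sym v∨w≈y))

    u≤v′ : u ≤ v ′
    u≤v′ = orthogonal⇒≤′ orth-uv

    u≤w′ : u ≤ w ′
    u≤w′ = orthogonal⇒≤′ orth-uw

    v≤w′ : v ≤ w ′
    v≤w′ = orthogonal⇒≤′ orth-vw

    y≤u′ : y ≤ u ′
    y≤u′ = trans (reflexive (Eq.sym v∨w≈y))
                 (∨-least (x≤y′⇒y≤x′ u≤v′) (x≤y′⇒y≤x′ u≤w′))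

    x≤w′ : x ≤ w ′
    x≤w′ = trans (reflexive (Eq.sym u∨v≈x)) (∨-least u≤w′ v≤w′)

    ≤u′∧x⇒≤v : ∀ {t} → t ≤ u ′ → t ≤ x → t ≤ v
    ≤u′∧x⇒≤v t≤u′ t≤x = ≤x′∧x∨y⇒≤y (x≤y′⇒y≤x′ u≤v′) t≤u′ (≤x⇒≤u∨v t≤x)

    ≤v′∧x⇒≤u : ∀ {t} → t ≤ v ′ → t ≤ x → t ≤ u
    ≤v′∧x⇒≤u t≤v′ t≤x = ≤y′∧x∨y⇒≤x u≤v′ t≤v′ (≤x⇒≤u∨v t≤x)

    ≤v′∧y⇒≤w : ∀ {t} → t ≤ v ′ → t ≤ y → t ≤ w
    ≤v′∧y⇒≤w t≤v′ t≤y = ≤x′∧x∨y⇒≤y (x≤y′⇒y≤x′ v≤w′) t≤v′ (≤y⇒≤v∨w t≤y)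

    ≤w′∧y⇒≤v : ∀ {t} → t ≤ w ′ → t ≤ y → t ≤ v
    ≤w′∧y⇒≤v t≤w′ t≤y = ≤y′∧x∨y⇒≤x v≤w′ t≤w′ (≤y⇒≤v∨w t≤y)

    u≈x∧y′ : u ≈ x ∧ y ′
    u≈x∧y′ = antisym (∧-greatest u≤x (x≤y′⇒y≤x′ y≤u′))
      (≤v′∧x⇒≤u (trans (x∧y≤y _ _) (antitone v y v≤y)) (x∧y≤x _ _))

    w≈x′∧y : w ≈ x ′ ∧ y
    w≈x′∧y = antisym (∧-greatest (x≤y′⇒y≤x′ x≤w′) w≤y)
      (≤v′∧y⇒≤w (trans (x∧y≤x _ _) (antitone v x v≤x)) (x∧y≤y _ _))

    v≈x∧y : v ≈ x ∧ y
    v≈x∧y = antisym (∧-greatest v≤x v≤y)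
      (≤u′∧x⇒≤v (trans (x∧y≤y _ _) y≤u′) (x∧y≤x _ _))

    v≈[x′∨y]∧x : v ≈ (x ′ ∨ y) ∧ x
    v≈[x′∨y]∧x = antisym (∧-greatest (trans v≤y (y≤x∨y _ _)) v≤x)
      (≤u′∧x⇒≤v (trans (x∧y≤x _ _) (∨-least (antitone u x u≤x) y≤u′)) (x∧y≤y _ _))

    v≈[x∨y′]∧y : v ≈ (x ∨ y ′) ∧ y
    v≈[x∨y′]∧y = antisym (∧-greatest (trans v≤x (x≤x∨y _ _)) v≤y)
      (≤w′∧y⇒≤v (trans (x∧y≤x _ _) (∨-least x≤w′ (antitone w y w≤y))) (x∧y≤y _ _))

mainTheorem7 : {c ℓ₁ ℓ₂ : Level} (L : BoundedLattice c ℓ₁ ℓ₂) →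
    let open BoundedLattice L in
    (_′ : Carrier → Carrier) → IsQuantumLogic L _′ →
    (x y u v w : Carrier) → CompatibleDecomposition L _′ x y u v w →
    (u ≈ (x ∧ (y ′))) × (w ≈ ((x ′) ∧ y)) ×
    (v ≈ (x ∧ y)) × ((x ∧ y) ≈ (((x ′) ∨ y) ∧ x)) × ((((x ′) ∨ y) ∧ x) ≈ ((x ∨ (y ′)) ∧ y))
mainTheorem7 L _′ Q x y u v w D =
  u≈x∧y′ , w≈x′∧y , v≈x∧y ,
  Eq.trans (Eq.sym v≈x∧y) v≈[x′∨y]∧x , Eq.trans (Eq.sym v≈[x′∨y]∧x) v≈[x∨y′]∧y
  where
    open BoundedLattice L
    open CompatibleDecompositionProperties L _′ Q D
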